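{- Let $G$ be a finite group and let $\Gamma=\mathrm{Cay}(G,S)$ be a connected bipartite Cayley graph with $2n$ vertices and valency $k$; let $H$ be the part (colour class) of $\Gamma$ containing the identity element. If $n$ is not divisible by $4$ and $0$ is not an eigenvalue of (the adjacency matrix of) $\Gamma$, then $G$ is isomorphic to a semidirect product $H\rtimes\mathbb{Z}_2$.
   Context: For a finite group $G$ and an inverse-closed subset $S\subseteq G\setminus\{e\}$, the Cayley graph $\mathrm{Cay}(G,S)$ has vertex set $G$, with $a$ adjacent to $b$ if and only if $ab^{ -1}\in S$. A semidirect product $H\rtimes K$ is a group $G$ containing a normal subgroup $H_1\cong H$ and a subgroup $K_1\cong K$ with $G=H_1K_1$ and $H_1\cap K_1=\{e\}$. -}

module Defs where

open import Level using (0ℓ)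
open import Data.Nat using (ℕ; zero; suc)
import Data.Nat as ℕ
open import Data.Fin using (Fin; zero; suc)
open import Data.Bool using (Bool; true; false; if_then_else_; T)
open import Data.List using (List; map; foldr; allFin)
open import Data.Product using (Σ; ∃; ∃-syntax; _×_; _,_)
open import Data.Rational using (ℚ; 0ℚ; _+_)
open import Algebra.Structures using (IsGroup)
open import Relation.Binary.PropositionalEquality using (_≡_; _≢_)
open import Relation.Binary.Construct.Closure.ReflexiveTransitive using (Star)
open import Relation.Unary using (Pred; _∈_)
open import Relation.Nullary using (¬_)

-- A finite group, presented (up to isomorphism) on the carrier Fin N,
-- with propositional equality.
record FinGroup : Set where
  field
    N       : ℕ
    _∙_     : Fin N → Fin N → Fin N
    ε       : Fin N
    _⁻¹     : Fin N → Fin N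
    isGroup : IsGroup _≡_ _∙_ ε _⁻¹
  infixl 7 _∙_
  infix 8 _⁻¹

module _ (G : FinGroup) where
  open FinGroup G

  ConnSet : Set
  ConnSet = Fin N → Bool

  IsCayleySet : ConnSet → Set
  IsCayleySet S = ((x : Fin N) → T (S x) → T (S (x ⁻¹))) × ¬ T (S ε)

  Adj : ConnSet → Fin N → Fin N → Set
  Adj S a b = T (S (a ∙ b ⁻¹))

  adjB : ConnSet → Fin N → Fin N → Bool
  adjB S a b = S (a ∙ b ⁻¹)

  Connected : ConnSet → Set
  Connected S = (a b : Fin N) → Star (Adj S) a b

  IsProper2Colouring : ConnSet → (Fin N → Bool) → Set
  IsProper2Colouring S c = (a b : Fin N) → Adj S a b → c a ≢ c b

  Bipartite : ConnSet → Set
  Bipartite S = Σ (Fin N → Bool) (IsProper2Colouring S)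

  degree : ConnSet → Fin N → ℕ
  degree S a = foldr ℕ._+_ 0 (map (λ b → if adjB S a b then 1 else 0) (allFin N))

  Regular : ConnSet → ℕ → Set
  Regular S k = (a : Fin N) → degree S a ≡ k

  adjAct : ConnSet → (Fin N → ℚ) → Fin N → ℚ
  adjAct S v a = foldr _+_ 0ℚ (map (λ b → if adjB S a b then v b else 0ℚ) (allFin N))

  ZeroIsEigenvalue : ConnSet → Set
  ZeroIsEigenvalue S =
    Σ (Fin N → ℚ) λ v → (∃[ a ] v a ≢ 0ℚ) × ((a : Fin N) → adjAct S v a ≡ 0ℚ)

  IsSubgroup : Pred (Fin N) 0ℓ → Set
  IsSubgroup A = (ε ∈ A)
               × ((x y : Fin N) → x ∈ A → y ∈ A → (x ∙ y) ∈ A)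
               × ((x : Fin N) → x ∈ A → (x ⁻¹) ∈ A)

  IsNormal : Pred (Fin N) 0ℓ → Set
  IsNormal A = (g h : Fin N) → h ∈ A → (g ∙ h ∙ g ⁻¹) ∈ A

  IsoSub : Pred (Fin N) 0ℓ → Pred (Fin N) 0ℓ → Set
  IsoSub A B = Σ (Fin N → Fin N) λ φ →
      ((x : Fin N) → x ∈ A → φ x ∈ B)
    × ((x y : Fin N) → x ∈ A → y ∈ A → φ (x ∙ y) ≡ φ x ∙ φ y)
    × ((x y : Fin N) → x ∈ A → y ∈ A → φ x ≡ φ y → x ≡ y)
    × ((y : Fin N) → y ∈ B → ∃[ x ] (x ∈ A × φ x ≡ y))

  _⊕₂_ : Fin 2 → Fin 2 → Fin 2
  zero ⊕₂ j = j
  suc zero ⊕₂ zero = suc zero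
  suc zero ⊕₂ suc zero = zero

  IsoZ2 : Pred (Fin N) 0ℓ → Set
  IsoZ2 K = Σ (Fin 2 → Fin N) λ ψ →
      ((i : Fin 2) → ψ i ∈ K)
    × ((i j : Fin 2) → ψ (i ⊕₂ j) ≡ ψ i ∙ ψ j)
    × ((i j : Fin 2) → ψ i ≡ ψ j → i ≡ j)
    × ((y : Fin N) → y ∈ K → ∃[ i ] ψ i ≡ y)

  -- G is (isomorphic to) a semidirect product H ⋊ ℤ₂, in the sense of the
  -- paper: G has a normal subgroup H₁ ≅ H and a subgroup K₁ ≅ ℤ₂ with
  -- G = H₁K₁ and H₁ ∩ K₁ = {e}.
  IsSemidirectHZ2 : Pred (Fin N) 0ℓ → Set₁
  IsSemidirectHZ2 H = Σ (Pred (Fin N) 0ℓ) λ H₁ → Σ (Pred (Fin N) 0ℓ) λ K₁ →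
      IsSubgroup H₁ × IsNormal H₁ × IsoSub H₁ H
    × IsSubgroup K₁ × IsoZ2 K₁
    × ((g : Fin N) → ∃[ h ] ∃[ k ] (h ∈ H₁ × k ∈ K₁ × g ≡ h ∙ k))
    × ((x : Fin N) → x ∈ H₁ → x ∈ K₁ → x ≡ ε)

module Submission where

-- The colour of a vertex relative to that of e is a homomorphism G → ℤ₂ (follow a walk to e and
-- translate it on the right), so the part H containing e is a subgroup of index two, |H| = n.
-- If some t ∉ H is an involution, G = H ⋊ {e, t}. Otherwise let σ(h) be the sign of the
-- permutation x ↦ h x of H, computed as the parity of its inversions; σ is a character of H.
-- An involution w ∈ H permutes H by n/2 disjoint transpositions, so σ(w) = 1 because 4 ∤ n.
-- Hence σ(x²) = 1 for every x ∉ H: otherwise all powers of x² have σ = 0, so none is a nontrivial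
-- involution, x² has odd order d, and x^d is an involution outside H. The vector that is (−1)^σ
-- on H and 0 off H then lies in the kernel of the adjacency matrix: the neighbours of a ∈ H lie
-- outside H, and the neighbours b and a b⁻¹ a = (a b⁻¹)² b of a ∉ H cancel.

open import Level using (0ℓ)
open import Function using (_∘_)
open import Function.Bundles using (Equivalence)
open import Function.Definitions using (Injective)
open import Data.Empty using (⊥-elim)
open import Data.Bool using (Bool; true; false; not; _∧_; _xor_; if_then_else_; T)
import Data.Bool.Properties as BoolP
open import Data.Nat as ℕ using (ℕ; zero; suc; _+_; _*_)
import Data.Nat.Properties as ℕP
open import Data.Nat.Divisibility using (_∣_; divides)
open import Data.Nat.Induction using (<-rec)
open import Data.Fin as Fin using (Fin; zero; suc)
import Data.Fin.Properties as FinP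
open import Data.Fin.Permutation using (permutation)
open import Data.Rational as ℚ using (ℚ; 0ℚ; 1ℚ; ½)
import Data.Rational.Properties as ℚP
open import Data.List using (foldr; map; allFin)
import Data.List as List
import Data.List.Properties as ListP
open import Data.Product using (∃; _×_; _,_; proj₁; curry)
open import Data.Sum using (_⊎_; inj₁; inj₂)
open import Algebra.Bundles using (Group)
open import Algebra.Structures using (IsGroup)
import Algebra.Properties.Group as GroupProperties
import Algebra.Properties.Monoid.Mult as MonoidMult
import Algebra.Properties.CommutativeMonoid.Sum as CommutativeMonoidSum
open import Algebra.Properties.CommutativeSemigroup ℕP.+-commutativeSemigroup using (interchange)
open import Relation.Binary.PropositionalEquality
  using (_≡_; _≢_; refl; sym; trans; cong; cong₂; subst; module ≡-Reasoning)
open import Relation.Binary.Definitions using (tri<; tri≈; tri>)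
open import Relation.Binary.Construct.Closure.ReflexiveTransitive using (Star; ε; _◅_)
open import Relation.Nullary using (¬_; Dec; yes; no; _×-dec_)
open import Relation.Nullary.Decidable using (⌊_⌋)
open import Relation.Unary using (Pred)
open import Defs

parity : ℕ → Bool
parity zero    = false
parity (suc n) = not (parity n)

parity-+ : ∀ m n → parity (m + n) ≡ parity m xor parity n
parity-+ zero    n = refl
parity-+ (suc m) n = trans (cong not (parity-+ m n)) (BoolP.not-distribˡ-xor (parity m) (parity n))

parity-double : ∀ m → parity (m + m) ≡ false
parity-double m = trans (parity-+ m m) (BoolP.xor-same (parity m))

parity-+-double : ∀ m k → parity (m + (k + k)) ≡ parity m
parity-+-double m k = trans (parity-+ m (k + k))
  (trans (cong (parity m xor_) (parity-double k)) (BoolP.xor-identityʳ (parity m)))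

parity≡false⇒double : ∀ m → parity m ≡ false → ∃ λ k → m ≡ k + k
parity≡false⇒double zero          _ = 0 , refl
parity≡false⇒double (suc zero)    ()
parity≡false⇒double (suc (suc m)) even with parity≡false⇒double m (trans (sym (BoolP.not-involutive _)) even)
... | k , refl = suc k , cong suc (sym (ℕP.+-suc k k))

double-injective : ∀ m n → m + m ≡ n + n → m ≡ n
double-injective zero    zero    _  = refl
double-injective (suc m) (suc n) eq = cong suc (double-injective m n
  (ℕP.suc-injective (trans (sym (ℕP.+-suc m m)) (trans (ℕP.suc-injective eq) (ℕP.+-suc n n)))))

¬4∣double⇒parity≡true : ∀ m → ¬ 4 ∣ (m + m) → parity m ≡ true
¬4∣double⇒parity≡true m 4∤2m with parity m in odd
... | true  = refl
... | false with parity≡false⇒double m odd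
... | k , refl = ⊥-elim (4∤2m (divides k (solve 1 (λ k → (k :+ k) :+ (k :+ k) := k :* con 4) refl k)))
  where open import Data.Nat.Solver using (module +-*-Solver); open +-*-Solver

χ : Bool → ℕ
χ b = if b then 1 else 0

χ-xor-split : ∀ a b x y → χ (a ∧ (b ∧ (x xor y))) ≡ χ (a ∧ (b ∧ (x ∧ not y))) + χ (b ∧ (a ∧ (not x ∧ y)))
χ-xor-split true  true  true  true  = refl
χ-xor-split true  true  true  false = refl
χ-xor-split true  true  false true  = refl
χ-xor-split true  true  false false = refl
χ-xor-split true  false x     y     = refl
χ-xor-split false true  x     y     = refl
χ-xor-split false false x     y     = refl

∧-xor-not-swap : ∀ a b x y → b ∧ (a ∧ (not x xor not y)) ≡ a ∧ (b ∧ (x xor y))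
∧-xor-not-swap true  true  true  true  = refl
∧-xor-not-swap true  true  true  false = refl
∧-xor-not-swap true  true  false true  = refl
∧-xor-not-swap true  true  false false = refl
∧-xor-not-swap true  false x     y     = refl
∧-xor-not-swap false true  x     y     = refl
∧-xor-not-swap false false x     y     = refl

-- x xor z = (x xor y) xor (y xor z), and χ (s xor t) + 2 χ (s ∧ t) = χ s + χ t.
χ-xor-triangle : ∀ a b x y z →
  let s = a ∧ (b ∧ (x xor y)); t = a ∧ (b ∧ (y xor z)) in
  χ (a ∧ (b ∧ (x xor z))) + (χ (s ∧ t) + χ (s ∧ t)) ≡ χ s + χ t
χ-xor-triangle true  true  true  true  true  = refl
χ-xor-triangle true  true  true  true  false = refl
χ-xor-triangle true  true  true  false true  = refl
χ-xor-triangle true  true  true  false false = refl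
χ-xor-triangle true  true  false true  true  = refl
χ-xor-triangle true  true  false true  false = refl
χ-xor-triangle true  true  false false true  = refl
χ-xor-triangle true  true  false false false = refl
χ-xor-triangle true  false x     y     z     = refl
χ-xor-triangle false b     x     y     z     = refl

∧-∧-comm : ∀ a b x y → b ∧ (a ∧ (y ∧ x)) ≡ a ∧ (b ∧ (x ∧ y))
∧-∧-comm a b x y = trans (BoolP.∧-comm b _) (trans (BoolP.∧-assoc a (y ∧ x) b)
  (cong (a ∧_) (trans (BoolP.∧-comm (y ∧ x) b) (cong (b ∧_) (BoolP.∧-comm y x)))))

∧-∧-false : ∀ a → a ∧ (a ∧ false) ≡ false
∧-∧-false true  = refl
∧-∧-false false = refl

∧-∧-∧-idem : ∀ a x → a ∧ (a ∧ (x ∧ x)) ≡ a ∧ x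
∧-∧-∧-idem true  x = BoolP.∧-idem x
∧-∧-∧-idem false x = refl

χ-split : ∀ x y → χ x ≡ (if y then χ x else 0) + χ (x ∧ not y)
χ-split x     true  = trans (sym (ℕP.+-identityʳ (χ x))) (cong (χ x +_) (cong χ (sym (BoolP.∧-zeroʳ x))))
χ-split x     false = cong χ (sym (BoolP.∧-identityʳ x))

≟-sym : ∀ {M} (u v : Fin M) → ⌊ u Fin.≟ v ⌋ ≡ ⌊ v Fin.≟ u ⌋
≟-sym u v with u Fin.≟ v | v Fin.≟ u
... | yes _   | yes _   = refl
... | no  _   | no  _   = refl
... | yes u≡v | no  v≢u = ⊥-elim (v≢u (sym u≡v))
... | no  u≢v | yes v≡u = ⊥-elim (u≢v (sym v≡u))

xor≡false⇒≡ : ∀ {x y} → x xor y ≡ false → x ≡ y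
xor≡false⇒≡ {false} {false} _ = refl
xor≡false⇒≡ {true}  {true}  _ = refl

T-ext : ∀ {a b} → (T a → T b) → (T b → T a) → a ≡ b
T-ext {false} {false} _   _   = refl
T-ext {false} {true}  _   b⇒a = ⊥-elim (b⇒a _)
T-ext {true}  {false} a⇒b _   = ⊥-elim (a⇒b _)
T-ext {true}  {true}  _   _   = refl

xor-∧ : ∀ x p → x xor (x ∧ p) ≡ x ∧ not p
xor-∧ true  p = refl
xor-∧ false p = refl

module ℕSum = CommutativeMonoidSum ℕP.+-0-commutativeMonoid
open ℕSum using (sum)

sum-reindex : ∀ {M} (f : Fin M → ℕ) {p q : Fin M → Fin M}
  → (∀ i → p (q i) ≡ i) → (∀ i → q (p i) ≡ i) → sum (f ∘ p) ≡ sum f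
sum-reindex f {p} {q} pq qp = sym (ℕSum.∑-permute f (permutation p q pq qp))

sum-const-1 : ∀ M → sum {M} (λ _ → 1) ≡ M
sum-const-1 zero    = refl
sum-const-1 (suc M) = cong suc (sum-const-1 M)

sum-delta : ∀ {M} (a : Fin M) (g : Fin M → ℕ) → sum (λ v → if ⌊ v Fin.≟ a ⌋ then g v else 0) ≡ g a
sum-delta {suc M} zero    g = trans (cong (g zero +_) (ℕSum.sum-replicate-zero M)) (ℕP.+-identityʳ (g zero))
sum-delta {suc M} (suc a) g = trans (ℕSum.sum-cong-≗ shift) (sum-delta a (g ∘ suc))
  where
  shift : ∀ v → (if ⌊ suc v Fin.≟ suc a ⌋ then g (suc v) else 0) ≡ (if ⌊ v Fin.≟ a ⌋ then g (suc v) else 0)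
  shift v with v Fin.≟ a
  ... | yes _ = refl
  ... | no  _ = refl

sum₂ : ∀ {M} → (Fin M → Fin M → ℕ) → ℕ
sum₂ F = sum (λ u → sum (F u))

sum₂-cong : ∀ {M} {F G : Fin M → Fin M → ℕ} → (∀ u v → F u v ≡ G u v) → sum₂ F ≡ sum₂ G
sum₂-cong F≗G = ℕSum.sum-cong-≗ (λ u → ℕSum.sum-cong-≗ (F≗G u))

sum₂-distrib-+ : ∀ {M} (F G : Fin M → Fin M → ℕ) → sum₂ (λ u v → F u v + G u v) ≡ sum₂ F + sum₂ G
sum₂-distrib-+ F G = trans (ℕSum.sum-cong-≗ (λ u → ℕSum.∑-distrib-+ (F u) (G u)))
                           (ℕSum.∑-distrib-+ (sum ∘ F) (sum ∘ G))

sum₂-swap : ∀ {M} (F : Fin M → Fin M → ℕ) → sum₂ (λ u v → F v u) ≡ sum₂ F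
sum₂-swap F = ℕSum.∑-comm (λ u v → F v u)

sum₂-reindex : ∀ {M} (F : Fin M → Fin M → ℕ) {p q : Fin M → Fin M}
  → (∀ i → p (q i) ≡ i) → (∀ i → q (p i) ≡ i) → sum₂ (λ u v → F (p u) (p v)) ≡ sum₂ F
sum₂-reindex F {p} pq qp =
  trans (ℕSum.sum-cong-≗ (λ u → sum-reindex (F (p u)) pq qp)) (sum-reindex (sum ∘ F) pq qp)

module Counting {X : Set} (∑ : (X → ℕ) → ℕ)
  (∑-cong : ∀ {f g} → (∀ x → f x ≡ g x) → ∑ f ≡ ∑ g)
  (∑-distrib-+ : ∀ f g → ∑ (λ x → f x + g x) ≡ ∑ f + ∑ g) where

  count : (X → Bool) → ℕ
  count P = ∑ (χ ∘ P)

  -- ι maps the elements of P satisfying h onto those not satisfying it;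
  -- the first hypothesis says that summing along ι is a reindexing.
  count-pairing : (P h : X → Bool) (ι : X → X)
    → count (λ x → P (ι x) ∧ not (h (ι x))) ≡ count (λ x → P x ∧ not (h x))
    → (∀ x → P (ι x) ≡ P x)
    → (∀ x → P x ≡ true → h (ι x) ≡ not (h x))
    → count P ≡ count (λ x → P x ∧ h x) + count (λ x → P x ∧ h x)
  count-pairing P h ι reindex P∘ι≡P flip = begin
    count P                                          ≡⟨ ∑-cong split ⟩
    ∑ (λ x → χ (P x ∧ h x) + χ (P x ∧ not (h x)))    ≡⟨ ∑-distrib-+ _ _ ⟩
    #Ph + count (λ x → P x ∧ not (h x))              ≡⟨ cong (#Ph +_) (sym reindex) ⟩
    #Ph + count (λ x → P (ι x) ∧ not (h (ι x)))      ≡⟨ cong (#Ph +_) (∑-cong matched) ⟩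
    #Ph + #Ph                                        ∎
    where
    open ≡-Reasoning
    #Ph = count (λ x → P x ∧ h x)
    split : ∀ x → χ (P x) ≡ χ (P x ∧ h x) + χ (P x ∧ not (h x))
    split x with P x | h x
    ... | true  | true  = refl
    ... | true  | false = refl
    ... | false | _     = refl
    matched : ∀ x → χ (P (ι x) ∧ not (h (ι x))) ≡ χ (P x ∧ h x)
    matched x with P x in Px
    ... | false rewrite P∘ι≡P x | Px = refl
    ... | true  rewrite P∘ι≡P x | Px | flip x Px with h x
    ...   | true  = refl
    ...   | false = refl

module FinCounting {M : ℕ} = Counting {Fin M} sum ℕSum.sum-cong-≗ ℕSum.∑-distrib-+
module PairCounting {M : ℕ} = Counting {Fin M × Fin M} (λ f → sum₂ (curry f))
  (λ f≗g → sum₂-cong (λ u v → f≗g (u , v))) (λ f g → sum₂-distrib-+ (curry f) (curry g))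

module Inversions {M : ℕ} (P : Fin M → Bool) where
  open FinCounting {M}
  open PairCounting {M} renaming (count to count₂; count-pairing to count₂-pairing)

  infix 7 _<ᵇ_
  _<ᵇ_ : Fin M → Fin M → Bool
  u <ᵇ v = ⌊ u Fin.<? v ⌋

  <ᵇ-irrefl : ∀ u → (u <ᵇ u) ≡ false
  <ᵇ-irrefl u with u Fin.<? u
  ... | yes u<u = ⊥-elim (FinP.<-irrefl refl u<u)
  ... | no  _   = refl

  <ᵇ-flip : ∀ {u v} → u ≢ v → (v <ᵇ u) ≡ not (u <ᵇ v)
  <ᵇ-flip {u} {v} u≢v with FinP.<-cmp u v | u Fin.<? v | v Fin.<? u
  ... | _             | yes u<v | yes v<u = ⊥-elim (FinP.<-asym u<v v<u)
  ... | _             | yes _   | no  _   = refl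
  ... | _             | no  _   | yes _   = refl
  ... | tri< u<v _ _  | no  u≮v | no  _   = ⊥-elim (u≮v u<v)
  ... | tri≈ _ u≡v _  | no  _   | no  _   = ⊥-elim (u≢v u≡v)
  ... | tri> _ _ v<u  | no  _   | no  v≮u = ⊥-elim (v≮u v<u)

  inversion : (Fin M → Fin M) → Fin M → Fin M → Bool
  inversion p u v = P u ∧ (P v ∧ (u <ᵇ v ∧ p v <ᵇ p u))

  inversions : (Fin M → Fin M) → ℕ
  inversions p = sum₂ (λ u v → χ (inversion p u v))

  sign : (Fin M → Fin M) → Bool
  sign p = parity (inversions p)

  sign-cong : ∀ {p p′} → (∀ u → p u ≡ p′ u) → sign p ≡ sign p′
  sign-cong p≗p′ = cong parity (sum₂-cong λ u v →
    cong₂ (λ x y → χ (P u ∧ (P v ∧ (u <ᵇ v ∧ x <ᵇ y)))) (p≗p′ v) (p≗p′ u))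

  discordant : (Fin M → Fin M) → Fin M → Fin M → Bool
  discordant p u v = P u ∧ (P v ∧ (u <ᵇ v xor p u <ᵇ p v))

  discordant-irrefl : ∀ p u → discordant p u u ≡ false
  discordant-irrefl p u rewrite <ᵇ-irrefl u | <ᵇ-irrefl (p u) = ∧-∧-false (P u)

  inversion-irrefl : ∀ p u → inversion p u u ≡ false
  inversion-irrefl p u rewrite <ᵇ-irrefl u = ∧-∧-false (P u)

  module _ {p : Fin M → Fin M} (p-injective : Injective _≡_ _≡_ p) where

    discordant-sym : ∀ u v → discordant p v u ≡ discordant p u v
    discordant-sym u v with u Fin.≟ v
    ... | yes refl = refl
    ... | no  u≢v rewrite <ᵇ-flip u≢v | <ᵇ-flip (u≢v ∘ p-injective) =
      ∧-xor-not-swap (P u) (P v) (u <ᵇ v) (p u <ᵇ p v)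

    discordances : sum₂ (λ u v → χ (discordant p u v)) ≡ inversions p + inversions p
    discordances = begin
      sum₂ (λ u v → χ (discordant p u v))                        ≡⟨ sum₂-cong split ⟩
      sum₂ (λ u v → χ (inversion p u v) + χ (inversion p v u))   ≡⟨ sum₂-distrib-+ I I′ ⟩
      inversions p + sum₂ I′                                     ≡⟨ cong (inversions p +_) (sum₂-swap I) ⟩
      inversions p + inversions p                                ∎
      where
      open ≡-Reasoning
      I I′ : Fin M → Fin M → ℕ
      I  u v = χ (inversion p u v)
      I′ u v = χ (inversion p v u)
      split : ∀ u v → χ (discordant p u v) ≡ χ (inversion p u v) + χ (inversion p v u)
      split u v with u Fin.≟ v
      ... | yes refl rewrite discordant-irrefl p u | inversion-irrefl p u = refl
      ... | no  u≢v rewrite <ᵇ-flip u≢v | <ᵇ-flip (u≢v ∘ p-injective) =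
        χ-xor-split (P u) (P v) (u <ᵇ v) (p u <ᵇ p v)


  module _ {p q q⁻¹ : Fin M → Fin M} (p-injective : Injective _≡_ _≡_ p)
           (q∘q⁻¹ : ∀ u → q (q⁻¹ u) ≡ u) (q⁻¹∘q : ∀ u → q⁻¹ (q u) ≡ u)
           (q-preserves-P : ∀ u → P (q u) ≡ P u) where

    private
      q-injective : Injective _≡_ _≡_ q
      q-injective {u} {v} qu≡qv = trans (sym (q⁻¹∘q u)) (trans (cong q⁻¹ qu≡qv) (q⁻¹∘q v))

      p∘q-injective : Injective _≡_ _≡_ (p ∘ q)
      p∘q-injective = q-injective ∘ p-injective

      doubly : Fin M × Fin M → Bool
      doubly (u , v) = discordant q u v ∧ discordant p (q u) (q v)

      J : ℕ
      J = count₂ (λ (u , v) → doubly (u , v) ∧ u <ᵇ v)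

      doubly-even : count₂ doubly ≡ J + J
      doubly-even = count₂-pairing doubly (λ (u , v) → u <ᵇ v) (λ (u , v) → v , u)
        (sum₂-swap (λ u v → χ (doubly (u , v) ∧ not (u <ᵇ v))))
        (λ (u , v) → cong₂ _∧_ (discordant-sym q-injective u v) (discordant-sym p-injective (q u) (q v)))
        (λ (u , v) uv-doubly → <ᵇ-flip (off-diagonal u v uv-doubly))
        where
        off-diagonal : ∀ u v → doubly (u , v) ≡ true → u ≢ v
        off-diagonal u .u uu-doubly refl with
          () ← trans (sym (cong (_∧ discordant p (q u) (q u)) (discordant-irrefl q u))) uu-doubly

      discordances-∘ : sum₂ (λ u v → χ (discordant (p ∘ q) u v)) + (count₂ doubly + count₂ doubly)
                     ≡ sum₂ (λ u v → χ (discordant q u v)) + sum₂ (λ u v → χ (discordant p u v))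
      discordances-∘ = begin
        sum₂ (λ u v → χ (discordant (p ∘ q) u v)) + (count₂ doubly + count₂ doubly)
          ≡⟨ cong (sum₂ (λ u v → χ (discordant (p ∘ q) u v)) +_) (sym (sum₂-distrib-+ D₂ D₂)) ⟩
        sum₂ (λ u v → χ (discordant (p ∘ q) u v)) + sum₂ (λ u v → D₂ u v + D₂ u v)
          ≡⟨ sym (sum₂-distrib-+ (λ u v → χ (discordant (p ∘ q) u v)) _) ⟩
        sum₂ (λ u v → χ (discordant (p ∘ q) u v) + (D₂ u v + D₂ u v))
          ≡⟨ sum₂-cong triangle ⟩
        sum₂ (λ u v → χ (discordant q u v) + χ (discordant p (q u) (q v)))
          ≡⟨ sum₂-distrib-+ (λ u v → χ (discordant q u v)) (λ u v → χ (discordant p (q u) (q v))) ⟩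
        sum₂ (λ u v → χ (discordant q u v)) + sum₂ (λ u v → χ (discordant p (q u) (q v)))
          ≡⟨ cong (sum₂ (λ u v → χ (discordant q u v)) +_)
                  (sum₂-reindex (λ u v → χ (discordant p u v)) q∘q⁻¹ q⁻¹∘q) ⟩
        sum₂ (λ u v → χ (discordant q u v)) + sum₂ (λ u v → χ (discordant p u v)) ∎
        where
        open ≡-Reasoning
        D₂ : Fin M → Fin M → ℕ
        D₂ u v = χ (doubly (u , v))
        triangle : ∀ u v → χ (discordant (p ∘ q) u v) + (D₂ u v + D₂ u v)
                         ≡ χ (discordant q u v) + χ (discordant p (q u) (q v))
        triangle u v rewrite q-preserves-P u | q-preserves-P v =
          χ-xor-triangle (P u) (P v) (u <ᵇ v) (q u <ᵇ q v) (p (q u) <ᵇ p (q v))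

    inversions-∘ : ∃ λ J → inversions (p ∘ q) + (J + J) ≡ inversions q + inversions p
    inversions-∘ = J , double-injective _ _ (begin
      (I[pq] + (J + J)) + (I[pq] + (J + J)) ≡⟨ interchange I[pq] (J + J) I[pq] (J + J) ⟩
      (I[pq] + I[pq]) + ((J + J) + (J + J))
        ≡⟨ cong₂ _+_ (sym (discordances p∘q-injective)) (cong₂ _+_ (sym doubly-even) (sym doubly-even)) ⟩
      sum₂ (λ u v → χ (discordant (p ∘ q) u v)) + (count₂ doubly + count₂ doubly)
        ≡⟨ discordances-∘ ⟩
      sum₂ (λ u v → χ (discordant q u v)) + sum₂ (λ u v → χ (discordant p u v))
        ≡⟨ cong₂ _+_ (discordances q-injective) (discordances p-injective) ⟩
      (I[q] + I[q]) + (I[p] + I[p])         ≡⟨ interchange I[q] I[q] I[p] I[p] ⟩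
      (I[q] + I[p]) + (I[q] + I[p])         ∎)
      where
      open ≡-Reasoning
      I[pq] = inversions (p ∘ q)
      I[p] = inversions p
      I[q] = inversions q

    sign-∘ : sign (p ∘ q) ≡ sign p xor sign q
    sign-∘ with inversions-∘
    ... | J , I[pq]+2J≡Iq+Ip = begin
      parity (inversions (p ∘ q))               ≡⟨ sym (parity-+-double (inversions (p ∘ q)) J) ⟩
      parity (inversions (p ∘ q) + (J + J))     ≡⟨ cong parity I[pq]+2J≡Iq+Ip ⟩
      parity (inversions q + inversions p)      ≡⟨ parity-+ (inversions q) (inversions p) ⟩
      sign q xor sign p                         ≡⟨ BoolP.xor-comm (sign q) (sign p) ⟩
      sign p xor sign q                         ∎
      where open ≡-Reasoning

  module _ {ι : Fin M → Fin M} (ι-involutive : ∀ u → ι (ι u) ≡ u)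
           (ι-fixed-point-free : ∀ u → ι u ≢ u) (ι-preserves-P : ∀ u → P (ι u) ≡ P u) where

    private
      A : ℕ
      A = count (λ u → P u ∧ u <ᵇ ι u)

      P-halved : count P ≡ A + A
      P-halved = count-pairing P (λ u → u <ᵇ ι u) ι
        (sum-reindex (λ u → χ (P u ∧ not (u <ᵇ ι u))) ι-involutive ι-involutive)
        ι-preserves-P
        (λ u _ → trans (cong (ι u <ᵇ_) (ι-involutive u)) (<ᵇ-flip (ι-fixed-point-free u ∘ sym)))

      partner : Fin M → Fin M → Bool
      partner u v = ⌊ v Fin.≟ ι u ⌋

      partner-ι : ∀ v → partner (ι v) v ≡ true
      partner-ι v with v Fin.≟ ι (ι v)
      ... | yes _     = refl
      ... | no  v≢ιιv = ⊥-elim (v≢ιιv (sym (ι-involutive v)))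

      partner-inversions : sum₂ (λ u v → if partner u v then χ (inversion ι u v) else 0) ≡ A
      partner-inversions = ℕSum.sum-cong-≗ λ u →
        trans (sum-delta (ι u) (χ ∘ inversion ι u)) (cong χ (at-partner u))
        where
        at-partner : ∀ u → inversion ι u (ι u) ≡ (P u ∧ u <ᵇ ι u)
        at-partner u rewrite ι-involutive u | ι-preserves-P u = ∧-∧-∧-idem (P u) (u <ᵇ ι u)

      stray : Fin M × Fin M → Bool
      stray (u , v) = inversion ι u v ∧ not (partner u v)

      J : ℕ
      J = count₂ (λ (u , v) → stray (u , v) ∧ u <ᵇ ι v)

      -- (u , v) ↦ (ι v , ι u) pairs up the inversions of ι other than (u , ι u)
      stray-even : count₂ stray ≡ J + J
      stray-even = count₂-pairing stray (λ (u , v) → u <ᵇ ι v) (λ (u , v) → ι v , ι u)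
        (trans (sum₂-swap (λ u v → F (ι u) (ι v))) (sum₂-reindex F ι-involutive ι-involutive))
        invariant flip
        where
        F : Fin M → Fin M → ℕ
        F u v = χ (stray (u , v) ∧ not (u <ᵇ ι v))
        invariant : ∀ ((u , v) : Fin M × Fin M) → stray (ι v , ι u) ≡ stray (u , v)
        invariant (u , v) rewrite ι-involutive u | ι-involutive v | ι-preserves-P u | ι-preserves-P v
                                | ≟-sym (ι u) v =
          cong (_∧ not (partner u v)) (∧-∧-comm (P u) (P v) (u <ᵇ v) (ι v <ᵇ ι u))
        flip : ∀ ((u , v) : Fin M × Fin M) → stray (u , v) ≡ true → (ι v <ᵇ ι (ι u)) ≡ not (u <ᵇ ι v)
        flip (u , v) uv-stray = trans (cong (ι v <ᵇ_) (ι-involutive u)) (<ᵇ-flip u≢ιv)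
          where
          u≢ιv : u ≢ ι v
          u≢ιv refl with () ← trans (sym (trans (cong (λ b → inversion ι (ι v) v ∧ not b) (partner-ι v))
                                                (BoolP.∧-zeroʳ (inversion ι (ι v) v)))) uv-stray

      inversions-involution : inversions ι ≡ A + (J + J)
      inversions-involution = begin
        inversions ι
          ≡⟨ sum₂-cong (λ u v → χ-split (inversion ι u v) (partner u v)) ⟩
        sum₂ (λ u v → partnerTerm u v + χ (stray (u , v)))
          ≡⟨ sum₂-distrib-+ partnerTerm (λ u v → χ (stray (u , v))) ⟩
        sum₂ partnerTerm + count₂ stray
          ≡⟨ cong₂ _+_ partner-inversions stray-even ⟩
        A + (J + J)
          ∎
        where
        open ≡-Reasoning
        partnerTerm : Fin M → Fin M → ℕ
        partnerTerm u v = if partner u v then χ (inversion ι u v) else 0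

    sign-involution : ∃ λ m → count P ≡ m + m × sign ι ≡ parity m
    sign-involution = A , P-halved , trans (cong parity inversions-involution) (parity-+-double A J)

module ℚSum = CommutativeMonoidSum ℚP.+-0-commutativeMonoid

foldr-tabulate≡sum : ∀ {M} (f : Fin M → ℚ) → foldr ℚ._+_ 0ℚ (List.tabulate f) ≡ ℚSum.sum f
foldr-tabulate≡sum {zero}  f = refl
foldr-tabulate≡sum {suc M} f = cong (f zero ℚ.+_) (foldr-tabulate≡sum (f ∘ suc))

foldr-allFin≡sum : ∀ {M} (f : Fin M → ℚ) → foldr ℚ._+_ 0ℚ (map f (allFin M)) ≡ ℚSum.sum f
foldr-allFin≡sum {M} f = trans (cong (foldr ℚ._+_ 0ℚ) (ListP.map-tabulate (λ i → i) f)) (foldr-tabulate≡sum f)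

x+x≡0⇒x≡0 : ∀ x → x ℚ.+ x ≡ 0ℚ → x ≡ 0ℚ
x+x≡0⇒x≡0 x x+x≡0 = begin
  x                     ≡⟨ sym (ℚP.*-identityʳ x) ⟩
  x ℚ.* (½ ℚ.+ ½)       ≡⟨ ℚP.*-distribˡ-+ x ½ ½ ⟩
  x ℚ.* ½ ℚ.+ x ℚ.* ½   ≡⟨ sym (ℚP.*-distribʳ-+ ½ x x) ⟩
  (x ℚ.+ x) ℚ.* ½       ≡⟨ cong (ℚ._* ½) x+x≡0 ⟩
  0ℚ ℚ.* ½              ≡⟨ ℚP.*-zeroˡ ½ ⟩
  0ℚ                    ∎
  where open ≡-Reasoning

sum-zero : ∀ {M} {f : Fin M → ℚ} → (∀ i → f i ≡ 0ℚ) → ℚSum.sum f ≡ 0ℚ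
sum-zero {M} f≡0 = trans (ℚSum.sum-cong-≗ f≡0) (ℚSum.sum-replicate-zero M)

sum-cancelling-involution : ∀ {M} (f : Fin M → ℚ) {ι : Fin M → Fin M}
  → (∀ i → ι (ι i) ≡ i) → (∀ i → f i ℚ.+ f (ι i) ≡ 0ℚ) → ℚSum.sum f ≡ 0ℚ
sum-cancelling-involution f {ι} ι-involutive cancel = x+x≡0⇒x≡0 (ℚSum.sum f) (begin
  ℚSum.sum f ℚ.+ ℚSum.sum f
    ≡⟨ cong (ℚSum.sum f ℚ.+_) (ℚSum.∑-permute f (permutation ι ι ι-involutive ι-involutive)) ⟩
  ℚSum.sum f ℚ.+ ℚSum.sum (f ∘ ι)  ≡⟨ sym (ℚSum.∑-distrib-+ f (f ∘ ι)) ⟩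
  ℚSum.sum (λ i → f i ℚ.+ f (ι i)) ≡⟨ sum-zero cancel ⟩
  0ℚ                               ∎)
  where open ≡-Reasoning

module FinGroupProperties (G : FinGroup) where
  open FinGroup G renaming (ε to e)
  open IsGroup isGroup using (identityʳ)

  group : Group 0ℓ 0ℓ
  group = record { isGroup = isGroup }

  open GroupProperties group public
    using (∙-cancelˡ; ∙-cancelʳ; ⁻¹-involutive; ⁻¹-anti-homo-∙; ε⁻¹≈ε; inverseʳ-unique;
           \\-leftDividesˡ; \\-leftDividesʳ; //-rightDividesˡ; //-rightDividesʳ)
  open MonoidMult (Group.monoid group) using (×-homo-+; ×-assocˡ) renaming (_×_ to _·_)

  infixr 8 _^_
  _^_ : Fin N → ℕ → Fin N
  x ^ k = k · x

  ^-+ : ∀ x m n → x ^ (m + n) ≡ x ^ m ∙ x ^ n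
  ^-+ = ×-homo-+

  ^-square : ∀ x m → (x ∙ x) ^ m ≡ x ^ (m + m)
  ^-square x m = begin
    (x ∙ x) ^ m      ≡⟨ cong (λ y → (x ∙ y) ^ m) (sym (identityʳ x)) ⟩
    (x ^ 2) ^ m      ≡⟨ ×-assocˡ x m 2 ⟩
    x ^ (m * 2)      ≡⟨ cong (x ^_) (trans (ℕP.*-comm m 2) (cong (m +_) (ℕP.+-identityʳ m))) ⟩
    x ^ (m + m)      ∎
    where open ≡-Reasoning

  x∙[x∙y⁻¹∙x]⁻¹≡[x∙y⁻¹]⁻¹ : ∀ x y → x ∙ (x ∙ y ⁻¹ ∙ x) ⁻¹ ≡ (x ∙ y ⁻¹) ⁻¹
  x∙[x∙y⁻¹∙x]⁻¹≡[x∙y⁻¹]⁻¹ x y = trans (cong (x ∙_) (⁻¹-anti-homo-∙ (x ∙ y ⁻¹) x)) (\\-leftDividesˡ x _)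

  finite-order : ∀ g → ∃ λ m → g ^ suc m ≡ e
  finite-order g with FinP.pigeonhole (ℕP.n<1+n N) (λ i → g ^ Fin.toℕ i)
  ... | i , j , i<j , gⁱ≡gʲ with ℕP.m≤n⇒∃[o]m+o≡n i<j
  ... | m , i+1+m≡j = m , sym (∙-cancelˡ (g ^ Fin.toℕ i) _ _ (begin
    g ^ Fin.toℕ i ∙ e             ≡⟨ identityʳ _ ⟩
    g ^ Fin.toℕ i                 ≡⟨ gⁱ≡gʲ ⟩
    g ^ Fin.toℕ j                 ≡⟨ cong (g ^_) (trans (sym i+1+m≡j) (sym (ℕP.+-suc (Fin.toℕ i) m))) ⟩
    g ^ (Fin.toℕ i + suc m)       ≡⟨ ^-+ g (Fin.toℕ i) (suc m) ⟩
    g ^ Fin.toℕ i ∙ g ^ suc m     ∎))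
    where open ≡-Reasoning

  odd-exponent : ∀ g → (∀ k → g ^ k ∙ g ^ k ≡ e → g ^ k ≡ e) → ∃ λ k → parity k ≡ true × g ^ k ≡ e
  odd-exponent g involution-free = let m , gᵐ⁺¹≡e = finite-order g in <-rec Goal halve m gᵐ⁺¹≡e
    where
    Goal : ℕ → Set
    Goal m = g ^ suc m ≡ e → ∃ λ k → parity k ≡ true × g ^ k ≡ e
    halve : ∀ m → (∀ {j} → j ℕ.< m → Goal j) → Goal m
    halve m rec gᵐ⁺¹≡e with parity (suc m) in odd
    ... | true  = suc m , odd , gᵐ⁺¹≡e
    ... | false with parity≡false⇒double (suc m) odd
    ...   | suc j , m+1≡2j+2 = rec j<m (involution-free (suc j) (begin
      g ^ suc j ∙ g ^ suc j   ≡⟨ sym (^-+ g (suc j) (suc j)) ⟩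
      g ^ (suc j + suc j)     ≡⟨ cong (g ^_) (sym m+1≡2j+2) ⟩
      g ^ suc m               ≡⟨ gᵐ⁺¹≡e ⟩
      e                       ∎))
      where
      open ≡-Reasoning
      j<m : j ℕ.< m
      j<m = subst (j ℕ.<_) (sym (ℕP.suc-injective m+1≡2j+2)) (ℕP.m<m+n j ℕ.z<s)

module Bipartition (G : FinGroup) (S : ConnSet G) (connected : Connected G S)
                   (c : Fin (FinGroup.N G) → Bool) (proper : IsProper2Colouring G S c) where
  open FinGroup G renaming (ε to e)
  open IsGroup isGroup using (assoc; identityˡ; identityʳ; inverseʳ)
  open FinGroupProperties G
  open FinCounting {N}

  side : Fin N → Bool
  side g = c g xor c e

  side-e : side e ≡ false
  side-e = BoolP.xor-same (c e)

  side≡false⇒sameColour : ∀ {a} → side a ≡ false → c a ≡ c e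
  side≡false⇒sameColour = xor≡false⇒≡

  sameColour⇒side≡false : ∀ {a} → c a ≡ c e → side a ≡ false
  sameColour⇒side≡false {a} ca≡ce = trans (cong (_xor c e) ca≡ce) side-e

  side-adjacent : ∀ {a b} → Adj G S a b → side a ≡ not (side b)
  side-adjacent {a} {b} a~b = trans (cong (_xor c e) (BoolP.¬-not (proper a b a~b)))
                                    (sym (BoolP.not-distribˡ-xor (c b) (c e)))

  Adj-∙ʳ : ∀ {a b} y → Adj G S a b → Adj G S (a ∙ y) (b ∙ y)
  Adj-∙ʳ {a} {b} y = subst (T ∘ S) (sym (begin
    a ∙ y ∙ (b ∙ y) ⁻¹        ≡⟨ cong (a ∙ y ∙_) (⁻¹-anti-homo-∙ b y) ⟩
    a ∙ y ∙ (y ⁻¹ ∙ b ⁻¹)     ≡⟨ assoc a y _ ⟩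
    a ∙ (y ∙ (y ⁻¹ ∙ b ⁻¹))   ≡⟨ cong (a ∙_) (\\-leftDividesˡ y (b ⁻¹)) ⟩
    a ∙ b ⁻¹                  ∎))
    where open ≡-Reasoning

  side-∙ : ∀ x y → side (x ∙ y) ≡ side x xor side y
  side-∙ x y = along (connected x e)
    where
    along : ∀ {x} → Star (Adj G S) x e → side (x ∙ y) ≡ side x xor side y
    along ε = trans (cong side (identityˡ y)) (cong (_xor side y) (sym side-e))
    along {x} (_◅_ {j = x′} x~x′ walk) = begin
      side (x ∙ y)                ≡⟨ side-adjacent (Adj-∙ʳ y x~x′) ⟩
      not (side (x′ ∙ y))         ≡⟨ cong not (along walk) ⟩
      not (side x′ xor side y)    ≡⟨ BoolP.not-distribˡ-xor (side x′) (side y) ⟩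
      not (side x′) xor side y    ≡⟨ cong (_xor side y) (sym (side-adjacent x~x′)) ⟩
      side x xor side y           ∎
      where open ≡-Reasoning

  side-⁻¹ : ∀ x → side (x ⁻¹) ≡ side x
  side-⁻¹ x = sym (xor≡false⇒≡ (trans (sym (side-∙ x (x ⁻¹))) (trans (cong side (inverseʳ x)) side-e)))

  side-S : ∀ {x} → T (S x) → side x ≡ true
  side-S {x} x∈S = trans (side-adjacent x~e) (cong not side-e)
    where
    x~e : Adj G S x e
    x~e = subst (T ∘ S) (sym (trans (cong (x ∙_) ε⁻¹≈ε) (identityʳ x))) x∈S

  outside-nonempty : ∀ {g} → g ≢ e → ∃ λ t → side t ≡ true
  outside-nonempty {g} g≢e with connected e g
  ... | ε                   = ⊥-elim (g≢e refl)
  ... | _◅_ {j = t} e~t _   = t , BoolP.not-injective (trans (sym (side-adjacent e~t)) side-e)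

  inH : Fin N → Bool
  inH = not ∘ side

  -- right translation by t exchanges the two parts
  index-two : ∀ {t} → side t ≡ true → count inH + count inH ≡ N
  index-two {t} t-outside = begin
    count inH + count inH
      ≡⟨ cong (count inH +_) (sym (sum-reindex (χ ∘ inH) (//-rightDividesˡ t) (//-rightDividesʳ t))) ⟩
    count inH + count (λ g → inH (g ∙ t))   ≡⟨ cong (count inH +_) (ℕSum.sum-cong-≗ (cong χ ∘ translate)) ⟩
    count inH + count side                  ≡⟨ sym (ℕSum.∑-distrib-+ (χ ∘ inH) (χ ∘ side)) ⟩
    sum (λ g → χ (inH g) + χ (side g))      ≡⟨ ℕSum.sum-cong-≗ (λ g → one-part (side g)) ⟩
    sum {N} (λ _ → 1)                       ≡⟨ sum-const-1 N ⟩
    N                                       ∎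
    where
    open ≡-Reasoning
    translate : ∀ g → inH (g ∙ t) ≡ side g
    translate g = trans (cong not (trans (side-∙ g t) (cong (side g xor_) t-outside)))
                        (trans (BoolP.not-distribʳ-xor (side g) true) (BoolP.xor-identityʳ (side g)))
    one-part : ∀ b → χ (not b) + χ b ≡ 1
    one-part true  = refl
    one-part false = refl

  semidirect : ∀ {t} → side t ≡ true → t ∙ t ≡ e → IsSemidirectHZ2 G (λ a → c a ≡ c e)
  semidirect {t} t∉H t²≡e = H , K , H-subgroup , H-normal , H≅H , K-subgroup , ℤ₂≅K , G≡HK , H∩K≡e
    where
    H K : Pred (Fin N) 0ℓ
    H a = c a ≡ c e
    K x = x ≡ e ⊎ x ≡ t

    t⁻¹≡t : t ⁻¹ ≡ t
    t⁻¹≡t = sym (inverseʳ-unique t t t²≡e)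

    t≢e : t ≢ e
    t≢e t≡e with () ← trans (sym t∉H) (trans (cong side t≡e) side-e)

    H-subgroup : IsSubgroup G H
    H-subgroup = refl
      , (λ x y x∈H y∈H → side≡false⇒sameColour (trans (side-∙ x y)
          (cong₂ _xor_ (sameColour⇒side≡false x∈H) (sameColour⇒side≡false y∈H))))
      , (λ x x∈H → side≡false⇒sameColour (trans (side-⁻¹ x) (sameColour⇒side≡false x∈H)))

    H-normal : IsNormal G H
    H-normal g h h∈H = side≡false⇒sameColour (begin
      side (g ∙ h ∙ g ⁻¹)              ≡⟨ side-∙ (g ∙ h) (g ⁻¹) ⟩
      side (g ∙ h) xor side (g ⁻¹)     ≡⟨ cong₂ _xor_ (side-∙ g h) (side-⁻¹ g) ⟩
      (side g xor side h) xor side g   ≡⟨ cong (λ s → (side g xor s) xor side g) (sameColour⇒side≡false h∈H) ⟩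
      (side g xor false) xor side g    ≡⟨ cong (_xor side g) (BoolP.xor-identityʳ (side g)) ⟩
      side g xor side g                ≡⟨ BoolP.xor-same (side g) ⟩
      false                            ∎)
      where open ≡-Reasoning

    H≅H : IsoSub G H H
    H≅H = (λ x → x) , (λ _ x∈H → x∈H) , (λ _ _ _ _ → refl) , (λ _ _ _ _ x≡y → x≡y)
        , (λ y y∈H → y , y∈H , refl)

    K-subgroup : IsSubgroup G K
    K-subgroup = inj₁ refl , closed , (λ { x (inj₁ refl) → inj₁ ε⁻¹≈ε ; x (inj₂ refl) → inj₂ t⁻¹≡t })
      where
      closed : ∀ x y → K x → K y → K (x ∙ y)
      closed x y (inj₁ refl) y∈K         = subst K (sym (identityˡ y)) y∈K
      closed x y (inj₂ refl) (inj₁ refl) = inj₂ (identityʳ x)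
      closed x y (inj₂ refl) (inj₂ refl) = inj₁ t²≡e

    ℤ₂≅K : IsoZ2 G K
    ℤ₂≅K = ψ , ψ∈K , ψ-hom , ψ-injective , ψ-surjective
      where
      ψ : Fin 2 → Fin N
      ψ zero       = e
      ψ (suc zero) = t
      ψ∈K : ∀ i → K (ψ i)
      ψ∈K zero       = inj₁ refl
      ψ∈K (suc zero) = inj₂ refl
      ψ-hom : ∀ i j → ψ (_⊕₂_ G i j) ≡ ψ i ∙ ψ j
      ψ-hom zero       zero       = sym (identityˡ e)
      ψ-hom zero       (suc zero) = sym (identityˡ t)
      ψ-hom (suc zero) zero       = sym (identityʳ t)
      ψ-hom (suc zero) (suc zero) = sym t²≡e
      ψ-injective : ∀ i j → ψ i ≡ ψ j → i ≡ j
      ψ-injective zero       zero       _   = refl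
      ψ-injective zero       (suc zero) e≡t = ⊥-elim (t≢e (sym e≡t))
      ψ-injective (suc zero) zero       t≡e = ⊥-elim (t≢e t≡e)
      ψ-injective (suc zero) (suc zero) _   = refl
      ψ-surjective : ∀ y → K y → ∃ λ i → ψ i ≡ y
      ψ-surjective y (inj₁ y≡e) = zero , sym y≡e
      ψ-surjective y (inj₂ y≡t) = suc zero , sym y≡t

    G≡HK : ∀ g → ∃ λ h → ∃ λ k → H h × K k × g ≡ h ∙ k
    G≡HK g with side g in side-g
    ... | false = g , e , side≡false⇒sameColour side-g , inj₁ refl , sym (identityʳ g)
    ... | true  = g ∙ t , t , side≡false⇒sameColour (trans (side-∙ g t) (cong₂ _xor_ side-g t∉H)) , inj₂ refl
                , sym (trans (assoc g t t) (trans (cong (g ∙_) t²≡e) (identityʳ g)))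

    H∩K≡e : ∀ x → H x → K x → x ≡ e
    H∩K≡e x _   (inj₁ x≡e) = x≡e
    H∩K≡e x t∈H (inj₂ refl) with () ← trans (sym t∉H) (sameColour⇒side≡false t∈H)

module SignCharacter (G : FinGroup) (S : ConnSet G) (connected : Connected G S)
                     (c : Fin (FinGroup.N G) → Bool) (proper : IsProper2Colouring G S c) where
  open FinGroup G renaming (ε to e)
  open IsGroup isGroup using (assoc; identityˡ)
  open FinGroupProperties G
  open Bipartition G S connected c proper
  open Inversions inH
  open FinCounting {N}

  σ : Fin N → Bool
  σ h = sign (h ∙_)

  σ-∙ : ∀ h {k} → side k ≡ false → σ (h ∙ k) ≡ σ h xor σ k
  σ-∙ h {k} k∈H = trans (sign-cong (assoc h k))
    (sign-∘ (∙-cancelˡ h _ _) (\\-leftDividesˡ k) (\\-leftDividesʳ k)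
            (λ u → cong not (trans (side-∙ k u) (cong (_xor side u) k∈H))))

  σ-e : σ e ≡ false
  σ-e = trans (cong σ (sym (identityˡ e))) (trans (σ-∙ e side-e) (BoolP.xor-same (σ e)))

  side-^ : ∀ x k → side (x ^ k) ≡ side x ∧ parity k
  side-^ x zero    = trans side-e (sym (BoolP.∧-zeroʳ (side x)))
  side-^ x (suc k) = trans (side-∙ x (x ^ k)) (trans (cong (side x xor_) (side-^ x k)) (xor-∧ (side x) (parity k)))

  σ-^ : ∀ {y} → side y ≡ false → σ y ≡ false → ∀ k → σ (y ^ k) ≡ false
  σ-^ y∈H σy≡false zero    = σ-e
  σ-^ {y} y∈H σy≡false (suc k) =
    trans (σ-∙ y (trans (side-^ y k) (cong (_∧ parity k) y∈H))) (cong₂ _xor_ σy≡false (σ-^ y∈H σy≡false k))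

  σ-involution : ∀ {w} → side w ≡ false → w ∙ w ≡ e → w ≢ e → ¬ 4 ∣ count inH → σ w ≡ true
  σ-involution {w} w∈H w²≡e w≢e 4∤|H| with sign-involution involutive fixed-point-free preserves-H
    where
    involutive : ∀ u → w ∙ (w ∙ u) ≡ u
    involutive u = trans (sym (assoc w w u)) (trans (cong (_∙ u) w²≡e) (identityˡ u))
    fixed-point-free : ∀ u → w ∙ u ≢ u
    fixed-point-free u wu≡u = w≢e (∙-cancelʳ u w e (trans wu≡u (sym (identityˡ u))))
    preserves-H : ∀ u → inH (w ∙ u) ≡ inH u
    preserves-H u = cong not (trans (side-∙ w u) (cong (_xor side u) w∈H))
  ... | m , |H|≡2m , σw≡parity-m =
    trans σw≡parity-m (¬4∣double⇒parity≡true m (subst (λ k → ¬ 4 ∣ k) |H|≡2m 4∤|H|))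

  module _ (4∤|H| : ¬ 4 ∣ count inH) (no-involution-outside : ∀ t → side t ≡ true → t ∙ t ≢ e) where

    σ-square : ∀ {x} → side x ≡ true → σ (x ∙ x) ≡ true
    σ-square {x} x∉H with σ (x ∙ x) in σx²
    ... | true  = refl
    ... | false with odd-exponent (x ∙ x) involution-free
      where
      x²∈H : side (x ∙ x) ≡ false
      x²∈H = trans (side-∙ x x) (cong₂ _xor_ x∉H x∉H)
      involution-free : ∀ k → (x ∙ x) ^ k ∙ (x ∙ x) ^ k ≡ e → (x ∙ x) ^ k ≡ e
      involution-free k y²≡e with (x ∙ x) ^ k FinP.≟ e
      ... | yes y≡e = y≡e
      ... | no  y≢e with () ← trans (sym (σ-^ x²∈H σx² k))
                                     (σ-involution (trans (side-^ (x ∙ x) k) (cong (_∧ parity k) x²∈H)) y²≡e y≢e 4∤|H|)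
    ... | d , odd , x²ᵈ≡e = ⊥-elim (no-involution-outside (x ^ d)
          (trans (side-^ x d) (trans (cong (_∧ parity d) x∉H) odd))
          (trans (sym (^-+ x d d)) (trans (sym (^-square x d)) x²ᵈ≡e)))

    module _ (S-inverse-closed : ∀ x → T (S x) → T (S (x ⁻¹))) where

      S-⁻¹ : ∀ x → S (x ⁻¹) ≡ S x
      S-⁻¹ x = T-ext (subst (T ∘ S) (⁻¹-involutive x) ∘ S-inverse-closed (x ⁻¹)) (S-inverse-closed x)

      kernelVector : Fin N → ℚ
      kernelVector g = if side g then 0ℚ else (if σ g then ℚ.- 1ℚ else 1ℚ)

      kernelVector-opposite : ∀ {b b′} → side b ≡ false → side b′ ≡ false → σ b′ ≡ not (σ b)
                            → kernelVector b ℚ.+ kernelVector b′ ≡ 0ℚ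
      kernelVector-opposite {b} b∈H b′∈H σb′≡¬σb rewrite b∈H | b′∈H | σb′≡¬σb with σ b
      ... | true  = refl
      ... | false = refl

      neighbourTerm : Fin N → Fin N → ℚ
      neighbourTerm a b = if adjB G S a b then kernelVector b else 0ℚ

      neighbourTerm-H : ∀ {a} → side a ≡ false → ∀ b → neighbourTerm a b ≡ 0ℚ
      neighbourTerm-H {a} a∈H b with S (a ∙ b ⁻¹) in a~b
      ... | false = refl
      ... | true with side b in side-b
      ...   | true  = refl
      ...   | false with () ← trans (sym (side-S (Equivalence.from BoolP.T-≡ a~b)))
                                    (trans (side-∙ a (b ⁻¹)) (cong₂ _xor_ a∈H (trans (side-⁻¹ b) side-b)))

      neighbourTerm-cancel : ∀ {a} → side a ≡ true → ∀ b
                           → neighbourTerm a b ℚ.+ neighbourTerm a (a ∙ b ⁻¹ ∙ a) ≡ 0ℚ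
      neighbourTerm-cancel {a} a∉H b rewrite x∙[x∙y⁻¹∙x]⁻¹≡[x∙y⁻¹]⁻¹ a b | S-⁻¹ (a ∙ b ⁻¹)
        with S (a ∙ b ⁻¹) in a~b
      ... | false = refl
      ... | true  = kernelVector-opposite b∈H b′∈H σb′≡¬σb
        where
        x = a ∙ b ⁻¹
        x∉H : side x ≡ true
        x∉H = side-S (Equivalence.from BoolP.T-≡ a~b)
        b∈H : side b ≡ false
        b∈H = BoolP.not-injective (trans (sym (trans (side-∙ a (b ⁻¹)) (cong₂ _xor_ a∉H (side-⁻¹ b)))) x∉H)
        b′∈H : side (x ∙ a) ≡ false
        b′∈H = trans (side-∙ x a) (cong₂ _xor_ x∉H a∉H)
        b′≡x²b : x ∙ a ≡ x ∙ x ∙ b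
        b′≡x²b = trans (cong (x ∙_) (sym (//-rightDividesˡ b a))) (sym (assoc x x b))
        σb′≡¬σb : σ (x ∙ a) ≡ not (σ b)
        σb′≡¬σb = trans (cong σ b′≡x²b) (trans (σ-∙ (x ∙ x) b∈H) (cong (_xor σ b) (σ-square x∉H)))

      adjAct-kernelVector : ∀ a → adjAct G S kernelVector a ≡ 0ℚ
      adjAct-kernelVector a with side a in side-a
      ... | false = trans (foldr-allFin≡sum (neighbourTerm a)) (sum-zero (neighbourTerm-H side-a))
      ... | true  = trans (foldr-allFin≡sum (neighbourTerm a))
                          (sum-cancelling-involution (neighbourTerm a) reflect-involutive (neighbourTerm-cancel side-a))
        where
        reflect-involutive : ∀ b → a ∙ (a ∙ b ⁻¹ ∙ a) ⁻¹ ∙ a ≡ b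
        reflect-involutive b = begin
          a ∙ (a ∙ b ⁻¹ ∙ a) ⁻¹ ∙ a     ≡⟨ cong (_∙ a) (x∙[x∙y⁻¹∙x]⁻¹≡[x∙y⁻¹]⁻¹ a b) ⟩
          (a ∙ b ⁻¹) ⁻¹ ∙ a             ≡⟨ cong (_∙ a) (⁻¹-anti-homo-∙ a (b ⁻¹)) ⟩
          b ⁻¹ ⁻¹ ∙ a ⁻¹ ∙ a            ≡⟨ //-rightDividesˡ a _ ⟩
          b ⁻¹ ⁻¹                       ≡⟨ ⁻¹-involutive b ⟩
          b                             ∎
          where open ≡-Reasoning

      zeroIsEigenvalue : ZeroIsEigenvalue G S
      zeroIsEigenvalue = kernelVector , (e , kernelVector-e≢0) , adjAct-kernelVector
        where
        kernelVector-e≢0 : kernelVector e ≢ 0ℚ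
        kernelVector-e≢0 rewrite side-e | σ-e = λ ()

another-element : ∀ {M} n (a : Fin M) → M ≡ 2 * n → ∃ λ g → g ≢ a
another-element {suc zero}    n _       1≡2n = ⊥-elim (ℕP.even≢odd n 0 (sym 1≡2n))
another-element {suc (suc M)} n zero    _    = suc zero , λ ()
another-element {suc (suc M)} n (suc a) _    = zero , λ ()

proposition3p5 : (G : FinGroup) (S : ConnSet G) (n k : ℕ)
    → IsCayleySet G S
    → Connected G S
    → (bip : Bipartite G S)
    → FinGroup.N G ≡ 2 * n
    → Regular G S k
    → ¬ (4 ∣ n)
    → ¬ ZeroIsEigenvalue G S
    → IsSemidirectHZ2 G (λ a → proj₁ bip a ≡ proj₁ bip (FinGroup.ε G))
proposition3p5 G S n _ (S-inverse-closed , _) connected (c , proper) |G|≡2n _ 4∤n ¬0-eigenvalue =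
  decompose (FinP.any? λ t → (side t BoolP.≟ true) ×-dec (t ∙ t FinP.≟ e))
  where
  open FinGroup G renaming (ε to e)
  open Bipartition G S connected c proper
  open SignCharacter G S connected c proper
  open FinCounting {N}

  |H|≡n : count inH ≡ n
  |H|≡n with another-element n e |G|≡2n
  ... | _ , g≢e with outside-nonempty g≢e
  ... | _ , t∉H = double-injective _ _ (trans (index-two t∉H) (trans |G|≡2n (cong (n +_) (ℕP.+-identityʳ n))))

  decompose : Dec (∃ λ t → side t ≡ true × t ∙ t ≡ e) → IsSemidirectHZ2 G (λ a → c a ≡ c e)
  decompose (yes (_ , t∉H , t²≡e)) = semidirect t∉H t²≡e
  decompose (no ∄t) = ⊥-elim (¬0-eigenvalue (zeroIsEigenvalue
    (subst (λ m → ¬ 4 ∣ m) (sym |H|≡n) 4∤n) (λ t t∉H t²≡e → ∄t (t , t∉H , t²≡e)) S-inverse-closed))
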